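{- Let $p$ be a prime and $N$ a positive integer. The minimal closed normal subgroup of $SL_2(\mathbb{Z}_p)$ containing $T^N=\begin{pmatrix}1&N\\0&1\end{pmatrix}$ is $\Gamma(N,\mathbb{Z}_p)$.
   Context: $\Gamma(N,\mathbb{Z}_p)$ is the kernel of the reduction map $SL_2(\mathbb{Z}_p)\to SL_2(\mathbb{Z}_p/N\mathbb{Z}_p)$; $SL_2(\mathbb{Z}_p)$ carries the $p$-adic topology. -}

module Defs where

open import Data.Nat as ℕ using (ℕ; suc; _≤_)
open import Data.Integer as ℤ using (ℤ; +_; _-_; -_)
open import Data.Integer.Divisibility.Signed using (_∣_; divides; ∣m∣n⇒∣m+n; ∣m⇒∣-m; ∣n⇒∣m*n; ∣m⇒∣m*n)
open import Data.Integer.Properties using (+-inverseʳ)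
open import Data.Integer.Solver using (module +-*-Solver)
open import Data.Product using (Σ; ∃; _×_; _,_)
open import Relation.Binary.PropositionalEquality using (_≡_; refl; subst; sym)


-- p-adic integers ℤ_p, modelled as the inverse limit lim ℤ/p^k:
-- a sequence of integers x k (representing x mod p^k) that is coherent,
-- i.e. x (k+1) ≡ x k (mod p^k).
Coherent : ℕ → (ℕ → ℤ) → Set
Coherent p x = ∀ k → (+ (p ℕ.^ k)) ∣ (x (suc k) - x k)

record ℤp (p : ℕ) : Set where
  constructor mkℤp
  field
    seq : ℕ → ℤ
    coh : Coherent p seq
open ℤp public

_≡[_^_]_ : ∀ {p} → ℤp p → ℕ → ℕ → ℤp p → Set
x ≡[ p ^ k ] y = (+ (p ℕ.^ k)) ∣ (seq x k - seq y k)

_≈_ : ∀ {p} → ℤp p → ℤp p → Set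
_≈_ {p} x y = ∀ k → x ≡[ p ^ k ] y

private
  open +-*-Solver
  addLem : ∀ a b c d → (a ℤ.+ c) - (b ℤ.+ d) ≡ (a - b) ℤ.+ (c - d)
  addLem = solve 4 (λ a b c d → (a :+ c) :- (b :+ d) := (a :- b) :+ (c :- d)) refl
  negLem : ∀ a b → (- a) - (- b) ≡ - (a - b)
  negLem = solve 2 (λ a b → (:- a) :- (:- b) := :- (a :- b)) refl
  mulLem : ∀ a b c d → (a ℤ.* c) - (b ℤ.* d) ≡ a ℤ.* (c - d) ℤ.+ (a - b) ℤ.* d
  mulLem = solve 4 (λ a b c d → (a :* c) :- (b :* d) := a :* (c :- d) :+ (a :- b) :* d) refl

infixl 6 _+ₚ_ _-ₚ_
infixl 7 _*ₚ_
infix 8 -ₚ_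
infixl 7 _·_
infix 4 _≈_ _≈M_

ι : ∀ {p} → ℤ → ℤp p
ι n = mkℤp (λ _ → n) (λ k → divides (+ 0) (+-inverseʳ n))

_+ₚ_ : ∀ {p} → ℤp p → ℤp p → ℤp p
x +ₚ y = mkℤp (λ k → seq x k ℤ.+ seq y k)
  (λ k → subst (_ ∣_) (sym (addLem (seq x (suc k)) (seq x k) (seq y (suc k)) (seq y k)))
                (∣m∣n⇒∣m+n (coh x k) (coh y k)))

-ₚ_ : ∀ {p} → ℤp p → ℤp p
-ₚ x = mkℤp (λ k → - seq x k)
  (λ k → subst (_ ∣_) (sym (negLem (seq x (suc k)) (seq x k))) (∣m⇒∣-m (coh x k)))

_-ₚ_ : ∀ {p} → ℤp p → ℤp p → ℤp p
x -ₚ y = x +ₚ (-ₚ y)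

_*ₚ_ : ∀ {p} → ℤp p → ℤp p → ℤp p
x *ₚ y = mkℤp (λ k → seq x k ℤ.* seq y k)
  (λ k → subst (_ ∣_) (sym (mulLem (seq x (suc k)) (seq x k) (seq y (suc k)) (seq y k)))
                (∣m∣n⇒∣m+n (∣n⇒∣m*n (seq x (suc k)) (coh y k)) (∣m⇒∣m*n (seq y k) (coh x k))))

0ₚ 1ₚ : ∀ {p} → ℤp p
0ₚ = ι (+ 0)
1ₚ = ι (+ 1)

_∣ₚ_ : ∀ {p} → ℕ → ℤp p → Set
_∣ₚ_ {p} N x = Σ (ℤp p) λ z → x ≈ (ι (+ N) *ₚ z)

record M2 (p : ℕ) : Set where
  constructor mat
  field
    a b c d : ℤp p
open M2 public

_·_ : ∀ {p} → M2 p → M2 p → M2 p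
g · h = mat (a g *ₚ a h +ₚ b g *ₚ c h) (a g *ₚ b h +ₚ b g *ₚ d h)
            (c g *ₚ a h +ₚ d g *ₚ c h) (c g *ₚ b h +ₚ d g *ₚ d h)

-- adjugate; this is the inverse for matrices of determinant 1
_⁻¹ : ∀ {p} → M2 p → M2 p
g ⁻¹ = mat (d g) (-ₚ b g) (-ₚ c g) (a g)

I : ∀ {p} → M2 p
I = mat 1ₚ 0ₚ 0ₚ 1ₚ

det : ∀ {p} → M2 p → ℤp p
det g = a g *ₚ d g -ₚ b g *ₚ c g

IsSL2 : ∀ {p} → M2 p → Set
IsSL2 g = det g ≈ 1ₚ

_≈M_ : ∀ {p} → M2 p → M2 p → Set
g ≈M h = (a g ≈ a h) × (b g ≈ b h) × (c g ≈ c h) × (d g ≈ d h)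

EqMod : ∀ {p} → ℕ → M2 p → M2 p → Set
EqMod {p} k g h = (a g ≡[ p ^ k ] a h) × (b g ≡[ p ^ k ] b h)
                × (c g ≡[ p ^ k ] c h) × (d g ≡[ p ^ k ] d h)

_⟶_ : ∀ {p} → (ℕ → M2 p) → M2 p → Set
gs ⟶ g = ∀ k → ∃ λ n₀ → ∀ n → n₀ ≤ n → EqMod k (gs n) g

module _ (p : ℕ) (H : M2 p → Set) where
  InSL2 : Set
  InSL2 = ∀ (g : M2 p) → H g → IsSL2 g
  Respects : Set
  Respects = ∀ (g h : M2 p) → g ≈M h → H g → H h
  HasOne : Set
  HasOne = H I
  MulClosed : Set
  MulClosed = ∀ (g h : M2 p) → H g → H h → H (g · h)
  InvClosed : Set
  InvClosed = ∀ (g : M2 p) → H g → H (g ⁻¹)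
  ConjClosed : Set
  ConjClosed = ∀ (g h : M2 p) → IsSL2 g → H h → H ((g · h) · (g ⁻¹))
  Closed : Set
  Closed = ∀ (gs : ℕ → M2 p) (g : M2 p) → (∀ n → H (gs n)) → gs ⟶ g → H g

IsClosedNormalSubgroup : (p : ℕ) → (M2 p → Set) → Set
IsClosedNormalSubgroup p H =
  InSL2 p H × Respects p H × HasOne p H × MulClosed p H ×
  InvClosed p H × ConjClosed p H × Closed p H

Γ : (p N : ℕ) → M2 p → Set
Γ p N g = IsSL2 g × (N ∣ₚ (a g -ₚ 1ₚ)) × (N ∣ₚ b g) × (N ∣ₚ c g) × (N ∣ₚ (d g -ₚ 1ₚ))

T^ : ∀ {p} → ℕ → M2 p
T^ N = mat 1ₚ (ι (+ N)) 0ₚ 1ₚ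

module Submission where

-- ℤ_p = lim ℤ/p^k, so facts about ℤ_p are proved level by level as integer
-- congruences modulo p^k; the file starts with this calculus, then equality
-- of p-adic integers and of matrices.  Γ(N) is the set of g ∈ SL₂ with g ≡ I
-- modulo the ideal N ℤ_p; reduction modulo N respects products and adjugates,
-- so Γ(N) is normal, and it is closed because N ℤ_p is (p^(k+N) ∣ N w forces
-- p^k ∣ w).  For minimality let H be closed, normal, with T^N = U(N) ∈ H.
-- Then U(N n) ∈ H for n ∈ ℤ, so U(t) ∈ H for t ∈ N ℤ_p by closedness, and by
-- conjugation L(t), V(t) = L(1) U(t) L(1)⁻¹ ∈ H.  If the entry a of g ∈ Γ(N)
-- is a unit (p ∤ a, inverted by a geometric series), g = L(s) V(1 - a) U(r)
-- with s, r ∈ N ℤ_p; if p ∣ a, then T^N g has unit entry a + N c.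

open import Defs
open import Data.Nat as ℕ using (ℕ; zero; suc; NonZero; _≤_; _≤′_; ≤′-refl; ≤′-step; s≤s; z≤n)
open import Data.Nat.Base using (nonTrivial⇒n>1)
import Data.Nat.Properties as ℕP
import Data.Nat.Divisibility as ℕD
open import Data.Nat.Primality using (Prime; euclidsLemma; prime⇒nonZero; prime⇒nonTrivial; prime⇒irreducible)
open import Data.Nat.Coprimality using (Coprime; coprime-Bézout)
open import Data.Nat.GCD using (module Bézout)
open import Data.Integer as ℤ using (ℤ; +_; -[1+_]; _-_; -_)
import Data.Integer.Properties as ℤP
open import Data.Integer.Divisibility.Signed
  using (_∣_; _∣?_; divides; ∣m∣n⇒∣m+n; ∣m⇒∣-m; ∣m⇒∣m*n; ∣n⇒∣m*n; ∣-refl; ∣-trans; ∣⇒∣ᵤ; ∣ᵤ⇒∣)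
open import Data.Integer.Tactic.RingSolver using (solve-∀)
open import Data.Empty using (⊥-elim)
open import Data.Product using (Σ; ∃; _×_; _,_; proj₁; proj₂)
open import Data.Sum using (inj₁; inj₂; [_,_]′)
open import Relation.Nullary using (¬_; Dec; yes; no)
open import Relation.Binary.Bundles using (Setoid)
open import Relation.Binary.PropositionalEquality using (_≡_; refl; sym; trans; cong; subst)
import Relation.Binary.PropositionalEquality as Eq
import Relation.Binary.Reasoning.Setoid as SetoidReasoning

-- It is wrapped in a record so that the
-- two sides can be inferred from the type.
record _≡_mod_ (x y m : ℤ) : Set where
  constructor mk-mod
  field divides-diff : m ∣ x - y
open _≡_mod_ public

infix 4 _≡_mod_

module _ {m : ℤ} where

  mod-reflexive : ∀ {x y} → x ≡ y → x ≡ y mod m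
  mod-reflexive {x} refl = mk-mod (divides (+ 0) (x-x≡0 x))
    where x-x≡0 : ∀ x → x - x ≡ + 0 ℤ.* m
          x-x≡0 = solve-∀

  mod-refl : ∀ {x} → x ≡ x mod m
  mod-refl = mod-reflexive refl

  mod-sym : ∀ {x y} → x ≡ y mod m → y ≡ x mod m
  mod-sym {x} {y} (mk-mod h) = mk-mod (subst (m ∣_) (lemma x y) (∣m⇒∣-m h))
    where lemma : ∀ x y → - (x - y) ≡ y - x
          lemma = solve-∀

  mod-trans : ∀ {x y z} → x ≡ y mod m → y ≡ z mod m → x ≡ z mod m
  mod-trans {x} {y} {z} (mk-mod h) (mk-mod h′) = mk-mod (subst (m ∣_) (lemma x y z) (∣m∣n⇒∣m+n h h′))
    where lemma : ∀ x y z → (x - y) ℤ.+ (y - z) ≡ x - z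
          lemma = solve-∀

  mod-+ : ∀ {x x′ y y′} → x ≡ x′ mod m → y ≡ y′ mod m → x ℤ.+ y ≡ x′ ℤ.+ y′ mod m
  mod-+ {x} {x′} {y} {y′} (mk-mod h) (mk-mod h′) =
    mk-mod (subst (m ∣_) (lemma x x′ y y′) (∣m∣n⇒∣m+n h h′))
    where lemma : ∀ x x′ y y′ → (x - x′) ℤ.+ (y - y′) ≡ (x ℤ.+ y) - (x′ ℤ.+ y′)
          lemma = solve-∀

  mod-neg : ∀ {x x′} → x ≡ x′ mod m → - x ≡ - x′ mod m
  mod-neg {x} {x′} (mk-mod h) = mk-mod (subst (m ∣_) (lemma x x′) (∣m⇒∣-m h))
    where lemma : ∀ x x′ → - (x - x′) ≡ (- x) - (- x′)
          lemma = solve-∀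

  mod-* : ∀ {x x′ y y′} → x ≡ x′ mod m → y ≡ y′ mod m → x ℤ.* y ≡ x′ ℤ.* y′ mod m
  mod-* {x} {x′} {y} {y′} (mk-mod h) (mk-mod h′) =
    mk-mod (subst (m ∣_) (lemma x x′ y y′) (∣m∣n⇒∣m+n (∣m⇒∣m*n y h) (∣n⇒∣m*n x′ h′)))
    where lemma : ∀ x x′ y y′ → (x - x′) ℤ.* y ℤ.+ x′ ℤ.* (y - y′) ≡ x ℤ.* y - x′ ℤ.* y′
          lemma = solve-∀

  ∣⇒≡0 : ∀ {x} → m ∣ x → x ≡ + 0 mod m
  ∣⇒≡0 {x} h = mk-mod (subst (m ∣_) (lemma x) h)
    where lemma : ∀ x → x ≡ x - + 0
          lemma = solve-∀

  ≡0⇒∣ : ∀ {x} → x ≡ + 0 mod m → m ∣ x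
  ≡0⇒∣ {x} (mk-mod h) = subst (m ∣_) (lemma x) h
    where lemma : ∀ x → x - + 0 ≡ x
          lemma = solve-∀

mod-weaken : ∀ {m m′ x y} → m ∣ m′ → x ≡ y mod m′ → x ≡ y mod m
mod-weaken d (mk-mod h) = mk-mod (∣-trans d h)

mod-setoid : ℤ → Setoid _ _
mod-setoid m = record
  { Carrier = ℤ
  ; _≈_ = λ x y → x ≡ y mod m
  ; isEquivalence = record { refl = mod-refl ; sym = mod-sym ; trans = mod-trans }
  }

-- Since ℤ's
-- operations unfold, the implicit arguments of mod-+ and mod-* cannot be
-- inferred from an unfolded goal; these variants take c explicitly.
mod-*ˡ : ∀ {m} c {y y′} → y ≡ y′ mod m → c ℤ.* y ≡ c ℤ.* y′ mod m
mod-*ˡ c {y} {y′} h = mod-* {x = c} {x′ = c} {y = y} {y′ = y′} mod-refl h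

mod-*ʳ : ∀ {m} c {y y′} → y ≡ y′ mod m → y ℤ.* c ≡ y′ ℤ.* c mod m
mod-*ʳ c {y} {y′} h = mod-* {x = y} {x′ = y′} {y = c} {y′ = c} h mod-refl

mod-sub : ∀ {m} c {y y′} → y ≡ y′ mod m → c - y ≡ c - y′ mod m
mod-sub c {y} {y′} h = mod-+ {x = c} {x′ = c} {y = - y} {y′ = - y′} mod-refl (mod-neg h)

mod-+ʳ : ∀ {m} c {y y′} → y ≡ y′ mod m → y ℤ.+ c ≡ y′ ℤ.+ c mod m
mod-+ʳ c {y} {y′} h = mod-+ {x = y} {x′ = y′} {y = c} {y′ = c} h mod-refl

mod-one : ∀ {x y} → x ≡ y mod + 1
mod-one {x} {y} = mk-mod (divides (x - y) (sym (ℤP.*-identityʳ (x - y))))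

inverses-agree : ∀ {m x x′ u u′} → x ℤ.* u ≡ + 1 mod m → x′ ℤ.* u′ ≡ + 1 mod m →
                 x ≡ x′ mod m → u ≡ u′ mod m
inverses-agree {m} {x} {x′} {u} {u′} xu≡1 x′u′≡1 x≡x′ = begin
  u                    ≡⟨ sym (ℤP.*-identityʳ u) ⟩
  u ℤ.* + 1            ≈⟨ mod-*ˡ u (mod-sym x′u′≡1) ⟩
  u ℤ.* (x′ ℤ.* u′)    ≡⟨ reassociate u x′ u′ ⟩
  (x′ ℤ.* u) ℤ.* u′    ≈⟨ mod-*ʳ u′ (mod-*ʳ u (mod-sym x≡x′)) ⟩
  (x ℤ.* u) ℤ.* u′     ≈⟨ mod-*ʳ u′ xu≡1 ⟩
  + 1 ℤ.* u′           ≡⟨ ℤP.*-identityˡ u′ ⟩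
  u′                   ∎
  where open SetoidReasoning (mod-setoid m)
        reassociate : ∀ u x u′ → u ℤ.* (x ℤ.* u′) ≡ (x ℤ.* u) ℤ.* u′
        reassociate = solve-∀

P : ℕ → ℕ → ℤ
P p k = + (p ℕ.^ k)

P-mono : ∀ {p k n} → k ≤ n → P p k ∣ P p n
P-mono {p} le = go (ℕP.≤⇒≤′ le)
  where go : ∀ {k n} → k ≤′ n → P p k ∣ P p n
        go ≤′-refl = ∣-refl
        go (≤′-step {n} le) = ∣-trans (go le) (∣ᵤ⇒∣ (ℕD.n∣m*n p {p ℕ.^ n}))

P1∣⇒∣ : ∀ p {z} → P p 1 ∣ z → p ℕD.∣ ℤ.∣ z ∣
P1∣⇒∣ p h = subst (ℕD._∣ _) (ℕP.*-identityʳ p) (∣⇒∣ᵤ h)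

∣⇒P1∣ : ∀ {p} z → p ℕD.∣ ℤ.∣ z ∣ → P p 1 ∣ z
∣⇒P1∣ {p} z h = ∣ᵤ⇒∣ {P p 1} {z} (subst (ℕD._∣ ℤ.∣ z ∣) (sym (ℕP.*-identityʳ p)) h)

coh≤ : ∀ {p k n} (x : ℤp p) → k ≤ n → seq x n ≡ seq x k mod P p k
coh≤ {p} {k} x le = go (ℕP.≤⇒≤′ le)
  where go : ∀ {n} → k ≤′ n → seq x n ≡ seq x k mod P p k
        go ≤′-refl = mod-refl
        go (≤′-step {n} le) = mod-trans (mod-weaken (P-mono (ℕP.≤′⇒≤ le)) (mk-mod (coh x n))) (go le)

-- Equality in ℤ_p (Defs' _≈_), wrapped in a record so that both sides are
-- inferable, and stated levelwise with the congruence of integers.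
record _≋_ {p : ℕ} (x y : ℤp p) : Set where
  constructor ≋-intro
  field at : ∀ k → seq x k ≡ seq y k mod P p k
open _≋_ public

infix 4 _≋_

module _ {p : ℕ} where

  ≈⇒≋ : {x y : ℤp p} → x ≈ y → x ≋ y
  ≈⇒≋ h = ≋-intro (λ k → mk-mod (h k))

  ≋⇒≈ : {x y : ℤp p} → x ≋ y → x ≈ y
  ≋⇒≈ e k = divides-diff (at e k)

  ≋-refl : {x : ℤp p} → x ≋ x
  ≋-refl = ≋-intro (λ k → mod-refl)

  ≋-sym : {x y : ℤp p} → x ≋ y → y ≋ x
  ≋-sym e = ≋-intro (λ k → mod-sym (at e k))

  ≋-trans : {x y z : ℤp p} → x ≋ y → y ≋ z → x ≋ z
  ≋-trans e e′ = ≋-intro (λ k → mod-trans (at e k) (at e′ k))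

  ℤp-setoid : Setoid _ _
  ℤp-setoid = record
    { Carrier = ℤp p ; _≈_ = _≋_
    ; isEquivalence = record { refl = ≋-refl ; sym = ≋-sym ; trans = ≋-trans } }

  +-cong : {x x′ y y′ : ℤp p} → x ≋ x′ → y ≋ y′ → x +ₚ y ≋ x′ +ₚ y′
  +-cong e e′ = ≋-intro (λ k → mod-+ (at e k) (at e′ k))

  neg-cong : {x x′ : ℤp p} → x ≋ x′ → -ₚ x ≋ -ₚ x′
  neg-cong e = ≋-intro (λ k → mod-neg (at e k))

  *-cong : {x x′ y y′ : ℤp p} → x ≋ x′ → y ≋ y′ → x *ₚ y ≋ x′ *ₚ y′
  *-cong e e′ = ≋-intro (λ k → mod-* (at e k) (at e′ k))

  -- The ring operations of ℤ_p act levelwise, so every polynomial identity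
  -- of ℤ holds in ℤ_p: it suffices to check it at each level.
  pw : {x y : ℤp p} → (∀ k → seq x k ≡ seq y k) → x ≋ y
  pw e = ≋-intro (λ k → mod-reflexive (e k))

  record _≋M_ (g h : M2 p) : Set where
    constructor M≋
    field ≋a : a g ≋ a h
          ≋b : b g ≋ b h
          ≋c : c g ≋ c h
          ≋d : d g ≋ d h
  open _≋M_ public

  infix 4 _≋M_

  ≈M⇒≋M : {g h : M2 p} → g ≈M h → g ≋M h
  ≈M⇒≋M (ea , eb , ec , ed) = M≋ (≈⇒≋ ea) (≈⇒≋ eb) (≈⇒≋ ec) (≈⇒≋ ed)

  ≋M⇒≈M : {g h : M2 p} → g ≋M h → g ≈M h
  ≋M⇒≈M e = ≋⇒≈ (≋a e) , ≋⇒≈ (≋b e) , ≋⇒≈ (≋c e) , ≋⇒≈ (≋d e)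

  ≋M-refl : {g : M2 p} → g ≋M g
  ≋M-refl = M≋ ≋-refl ≋-refl ≋-refl ≋-refl

  ≋M-sym : {g h : M2 p} → g ≋M h → h ≋M g
  ≋M-sym (M≋ ea eb ec ed) = M≋ (≋-sym ea) (≋-sym eb) (≋-sym ec) (≋-sym ed)

  ≋M-trans : {g h j : M2 p} → g ≋M h → h ≋M j → g ≋M j
  ≋M-trans (M≋ ea eb ec ed) (M≋ fa fb fc fd) =
    M≋ (≋-trans ea fa) (≋-trans eb fb) (≋-trans ec fc) (≋-trans ed fd)

  -- Intermediate results are bound by
  -- let, so that their types are inferred from the hypotheses: unifying the
  -- congruence lemmas against unfolded products instead is very slow.
  ·-cong : {g g′ h h′ : M2 p} → g ≋M g′ → h ≋M h′ → g · h ≋M g′ · h′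
  ·-cong (M≋ ea eb ec ed) (M≋ fa fb fc fd) =
    let a≋ = +-cong (*-cong ea fa) (*-cong eb fc) ; b≋ = +-cong (*-cong ea fb) (*-cong eb fd)
        c≋ = +-cong (*-cong ec fa) (*-cong ed fc) ; d≋ = +-cong (*-cong ec fb) (*-cong ed fd)
    in M≋ a≋ b≋ c≋ d≋

  det-cong : {g h : M2 p} → g ≋M h → det g ≋ det h
  det-cong (M≋ ea eb ec ed) = let det≋ = +-cong (*-cong ea ed) (neg-cong (*-cong eb ec)) in det≋

  level : ∀ {k} (x y : ℤp p) → x ≡[ p ^ k ] y → seq x k ≡ seq y k mod P p k
  level x y h = mk-mod h

  det-level : ∀ {k} (g h : M2 p) → EqMod k g h →
              seq (det g) k ≡ seq (det h) k mod P p k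
  det-level g h (ea , eb , ec , ed) =
    mod-+ (mod-* (level (a g) (a h) ea) (level (d g) (d h) ed))
          (mod-neg (mod-* (level (b g) (b h) eb) (level (c g) (c h) ec)))

  -- membership in SL₂, phrased with _≋_ (the matrix is given explicitly,
  -- since it cannot be recovered from the unfolded type IsSL2 g)
  SL-intro : (g : M2 p) → det g ≋ 1ₚ → IsSL2 g
  SL-intro g e = ≋⇒≈ e

  SL-elim : (g : M2 p) → IsSL2 g → det g ≋ 1ₚ
  SL-elim g sg = ≈⇒≋ sg

module _ {p : ℕ} where

  det-· : (g h : M2 p) → det (g · h) ≋ det g *ₚ det h
  det-· g h = pw (λ k → identity (seq (a g) k) (seq (b g) k) (seq (c g) k) (seq (d g) k)
                                 (seq (a h) k) (seq (b h) k) (seq (c h) k) (seq (d h) k))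
    where identity : ∀ A B C D E F G H →
            (A ℤ.* E ℤ.+ B ℤ.* G) ℤ.* (C ℤ.* F ℤ.+ D ℤ.* H) - (A ℤ.* F ℤ.+ B ℤ.* H) ℤ.* (C ℤ.* E ℤ.+ D ℤ.* G)
            ≡ (A ℤ.* D - B ℤ.* C) ℤ.* (E ℤ.* H - F ℤ.* G)
          identity = solve-∀

  det-⁻¹ : (g : M2 p) → det (g ⁻¹) ≋ det g
  det-⁻¹ g = pw (λ k → identity (seq (a g) k) (seq (b g) k) (seq (c g) k) (seq (d g) k))
    where identity : ∀ A B C D → D ℤ.* A - (- B) ℤ.* (- C) ≡ A ℤ.* D - B ℤ.* C
          identity = solve-∀

  SL-resp : {g h : M2 p} → g ≋M h → IsSL2 g → IsSL2 h
  SL-resp {g} {h} e sg = SL-intro h (≋-trans (≋-sym (det-cong e)) (SL-elim g sg))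

  SL-· : (g h : M2 p) → IsSL2 g → IsSL2 h → IsSL2 (g · h)
  SL-· g h sg sh = let det≋ = *-cong (SL-elim g sg) (SL-elim h sh) in
    SL-intro (g · h) (≋-trans (det-· g h) (≋-trans det≋ (pw (λ k → refl))))

  SL-⁻¹ : (g : M2 p) → IsSL2 g → IsSL2 (g ⁻¹)
  SL-⁻¹ g sg = SL-intro (g ⁻¹) (≋-trans (det-⁻¹ g) (SL-elim g sg))

  SL-I : IsSL2 (I {p})
  SL-I = SL-intro I (pw (λ k → refl))

  ·-identityʳ : (g : M2 p) → g · I ≋M g
  ·-identityʳ g = M≋ (pw (λ k → identity (seq (a g) k) (seq (b g) k)))
                     (pw (λ k → identity′ (seq (a g) k) (seq (b g) k)))
                     (pw (λ k → identity (seq (c g) k) (seq (d g) k)))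
                     (pw (λ k → identity′ (seq (c g) k) (seq (d g) k)))
    where identity : ∀ A B → A ℤ.* + 1 ℤ.+ B ℤ.* + 0 ≡ A
          identity = solve-∀
          identity′ : ∀ A B → A ℤ.* + 0 ℤ.+ B ℤ.* + 1 ≡ B
          identity′ = solve-∀

  I⁻¹ : I ⁻¹ ≋M I {p}
  I⁻¹ = M≋ ≋-refl (pw (λ k → refl)) (pw (λ k → refl)) ≋-refl

  ·-inverseʳ : (g : M2 p) → IsSL2 g → g · g ⁻¹ ≋M I
  ·-inverseʳ g sg =
    M≋ (≋-trans (pw (λ k → diagonal (A k) (B k) (C k) (D k))) (SL-elim g sg))
       (pw (λ k → off-diagonal (A k) (B k)))
       (pw (λ k → off-diagonal′ (C k) (D k)))
       (≋-trans (pw (λ k → diagonal′ (A k) (B k) (C k) (D k))) (SL-elim g sg))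
    where
      A B C D : ℕ → ℤ
      A = seq (a g) ; B = seq (b g) ; C = seq (c g) ; D = seq (d g)
      diagonal : ∀ A B C D → A ℤ.* D ℤ.+ B ℤ.* (- C) ≡ A ℤ.* D - B ℤ.* C
      diagonal = solve-∀
      diagonal′ : ∀ A B C D → C ℤ.* (- B) ℤ.+ D ℤ.* A ≡ A ℤ.* D - B ℤ.* C
      diagonal′ = solve-∀
      off-diagonal : ∀ A B → A ℤ.* (- B) ℤ.+ B ℤ.* A ≡ + 0
      off-diagonal = solve-∀
      off-diagonal′ : ∀ C D → C ℤ.* D ℤ.+ D ℤ.* (- C) ≡ + 0
      off-diagonal′ = solve-∀

  ⁻¹-cancelˡ : (h g : M2 p) → IsSL2 h → h ⁻¹ · (h · g) ≋M g
  ⁻¹-cancelˡ h g sh =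
    M≋ (scaled (λ k → top-identity (A k) (B k) (C k) (D k) (seq (a g) k) (seq (c g) k)))
       (scaled (λ k → top-identity (A k) (B k) (C k) (D k) (seq (b g) k) (seq (d g) k)))
       (scaled (λ k → bottom-identity (A k) (B k) (C k) (D k) (seq (a g) k) (seq (c g) k)))
       (scaled (λ k → bottom-identity (A k) (B k) (C k) (D k) (seq (b g) k) (seq (d g) k)))
    where
      A B C D : ℕ → ℤ
      A = seq (a h) ; B = seq (b h) ; C = seq (c h) ; D = seq (d h)
      scaled : ∀ {x y : ℤp p} → (∀ k → seq x k ≡ seq (det h *ₚ y) k) → x ≋ y
      scaled {y = y} e = ≋-trans (pw e) (≋-trans (*-cong (SL-elim h sh) (≋-refl {x = y})) (pw (λ k → one-* (seq y k))))
        where one-* : ∀ X → + 1 ℤ.* X ≡ X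
              one-* = solve-∀
      top-identity : ∀ A B C D X Y → D ℤ.* (A ℤ.* X ℤ.+ B ℤ.* Y) ℤ.+ (- B) ℤ.* (C ℤ.* X ℤ.+ D ℤ.* Y)
                                     ≡ (A ℤ.* D - B ℤ.* C) ℤ.* X
      top-identity = solve-∀
      bottom-identity : ∀ A B C D X Y → (- C) ℤ.* (A ℤ.* X ℤ.+ B ℤ.* Y) ℤ.+ A ℤ.* (C ℤ.* X ℤ.+ D ℤ.* Y)
                                        ≡ (A ℤ.* D - B ℤ.* C) ℤ.* Y
      bottom-identity = solve-∀

record _≋_mod_ {p : ℕ} (x y : ℤp p) (N : ℕ) : Set where
  constructor ≋mod
  field quotient : ℤp p
        multiple : x -ₚ y ≋ ι (+ N) *ₚ quotient
open _≋_mod_ public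

infix 4 _≋_mod_

module _ {p : ℕ} {N : ℕ} where
  open SetoidReasoning (ℤp-setoid {p})

  private
    n : ℤp p
    n = ι (+ N)

    minus-zero : (x : ℤp p) → x -ₚ 0ₚ ≋ x
    minus-zero x = pw (λ k → identity (seq x k))
      where identity : ∀ X → X ℤ.+ - (+ 0) ≡ X
            identity = solve-∀

  ∣ₚ⇒≋mod : (x y : ℤp p) → N ∣ₚ (x -ₚ y) → x ≋ y mod N
  ∣ₚ⇒≋mod x y (q , h) = ≋mod q (≈⇒≋ h)

  ≋mod⇒∣ₚ : {x y : ℤp p} → x ≋ y mod N → N ∣ₚ (x -ₚ y)
  ≋mod⇒∣ₚ (≋mod q h) = q , ≋⇒≈ h

  ∣ₚ⇒≋0 : (x : ℤp p) → N ∣ₚ x → x ≋ 0ₚ mod N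
  ∣ₚ⇒≋0 x (q , h) = ≋mod q (≋-trans (minus-zero x) (≈⇒≋ h))

  ≋0⇒∣ₚ : {x : ℤp p} → x ≋ 0ₚ mod N → N ∣ₚ x
  ≋0⇒∣ₚ {x} (≋mod q h) = q , ≋⇒≈ (≋-trans (≋-sym (minus-zero x)) h)

  ≋⇒≋mod : {x y : ℤp p} → x ≋ y → x ≋ y mod N
  ≋⇒≋mod {x} {y} e = let step = +-cong e (≋-refl {x = -ₚ y}) in ≋mod 0ₚ (begin
    x -ₚ y  ≈⟨ step ⟩
    y -ₚ y  ≈⟨ pw (λ k → identity (seq y k) (+ N)) ⟩
    n *ₚ 0ₚ ∎)
    where identity : ∀ Y N → Y ℤ.+ - Y ≡ N ℤ.* + 0
          identity = solve-∀

  ≋mod-trans : {x y z : ℤp p} → x ≋ y mod N → y ≋ z mod N → x ≋ z mod N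
  ≋mod-trans {x} {y} {z} (≋mod q h) (≋mod q′ h′) = let step = +-cong h h′ in ≋mod (q +ₚ q′) (begin
    x -ₚ z                   ≈⟨ pw (λ k → split (seq x k) (seq y k) (seq z k)) ⟩
    (x -ₚ y) +ₚ (y -ₚ z)     ≈⟨ step ⟩
    n *ₚ q +ₚ n *ₚ q′        ≈⟨ pw (λ k → factor (+ N) (seq q k) (seq q′ k)) ⟩
    n *ₚ (q +ₚ q′)           ∎)
    where split : ∀ X Y Z → X ℤ.+ - Z ≡ (X ℤ.+ - Y) ℤ.+ (Y ℤ.+ - Z)
          split = solve-∀
          factor : ∀ N Q Q′ → N ℤ.* Q ℤ.+ N ℤ.* Q′ ≡ N ℤ.* (Q ℤ.+ Q′)
          factor = solve-∀

  ≋mod-+ : {x x′ y y′ : ℤp p} → x ≋ x′ mod N → y ≋ y′ mod N → x +ₚ y ≋ x′ +ₚ y′ mod N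
  ≋mod-+ {x} {x′} {y} {y′} (≋mod q h) (≋mod q′ h′) = let step = +-cong h h′ in ≋mod (q +ₚ q′) (begin
    (x +ₚ y) -ₚ (x′ +ₚ y′)   ≈⟨ pw (λ k → split (seq x k) (seq x′ k) (seq y k) (seq y′ k)) ⟩
    (x -ₚ x′) +ₚ (y -ₚ y′)   ≈⟨ step ⟩
    n *ₚ q +ₚ n *ₚ q′        ≈⟨ pw (λ k → factor (+ N) (seq q k) (seq q′ k)) ⟩
    n *ₚ (q +ₚ q′)           ∎)
    where split : ∀ X X′ Y Y′ → (X ℤ.+ Y) ℤ.+ - (X′ ℤ.+ Y′) ≡ (X ℤ.+ - X′) ℤ.+ (Y ℤ.+ - Y′)
          split = solve-∀
          factor : ∀ N Q Q′ → N ℤ.* Q ℤ.+ N ℤ.* Q′ ≡ N ℤ.* (Q ℤ.+ Q′)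
          factor = solve-∀

  ≋mod-neg : {x x′ : ℤp p} → x ≋ x′ mod N → -ₚ x ≋ -ₚ x′ mod N
  ≋mod-neg {x} {x′} (≋mod q h) = let step = neg-cong h in ≋mod (-ₚ q) (begin
    -ₚ x -ₚ -ₚ x′   ≈⟨ pw (λ k → swap (seq x k) (seq x′ k)) ⟩
    -ₚ (x -ₚ x′)    ≈⟨ step ⟩
    -ₚ (n *ₚ q)     ≈⟨ pw (λ k → neg-* (+ N) (seq q k)) ⟩
    n *ₚ (-ₚ q)     ∎)
    where swap : ∀ X X′ → (- X) ℤ.+ - (- X′) ≡ - (X ℤ.+ - X′)
          swap = solve-∀
          neg-* : ∀ N Q → - (N ℤ.* Q) ≡ N ℤ.* (- Q)
          neg-* = solve-∀

  ≋mod-* : {x x′ y y′ : ℤp p} → x ≋ x′ mod N → y ≋ y′ mod N → x *ₚ y ≋ x′ *ₚ y′ mod N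
  ≋mod-* {x} {x′} {y} {y′} (≋mod q h) (≋mod q′ h′) =
    let step = +-cong (*-cong h (≋-refl {x = y})) (*-cong (≋-refl {x = x′}) h′) in
    ≋mod (q *ₚ y +ₚ x′ *ₚ q′) (begin
    x *ₚ y -ₚ x′ *ₚ y′                      ≈⟨ pw (λ k → split (seq x k) (seq x′ k) (seq y k) (seq y′ k)) ⟩
    (x -ₚ x′) *ₚ y +ₚ x′ *ₚ (y -ₚ y′)       ≈⟨ step ⟩
    (n *ₚ q) *ₚ y +ₚ x′ *ₚ (n *ₚ q′)        ≈⟨ pw (λ k → factor (+ N) (seq q k) (seq q′ k) (seq y k) (seq x′ k)) ⟩
    n *ₚ (q *ₚ y +ₚ x′ *ₚ q′)               ∎)
    where split : ∀ X X′ Y Y′ → X ℤ.* Y ℤ.+ - (X′ ℤ.* Y′) ≡ (X ℤ.+ - X′) ℤ.* Y ℤ.+ X′ ℤ.* (Y ℤ.+ - Y′)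
          split = solve-∀
          factor : ∀ N Q Q′ Y X′ → (N ℤ.* Q) ℤ.* Y ℤ.+ X′ ℤ.* (N ℤ.* Q′) ≡ N ℤ.* (Q ℤ.* Y ℤ.+ X′ ℤ.* Q′)
          factor = solve-∀

record _≋M_mod_ {p : ℕ} (g h : M2 p) (N : ℕ) : Set where
  constructor M≋mod
  field ≋a-mod : a g ≋ a h mod N
        ≋b-mod : b g ≋ b h mod N
        ≋c-mod : c g ≋ c h mod N
        ≋d-mod : d g ≋ d h mod N
open _≋M_mod_ public

infix 4 _≋M_mod_

module _ {p : ℕ} {N : ℕ} where

  ≋M⇒≋Mmod : {g h : M2 p} → g ≋M h → g ≋M h mod N
  ≋M⇒≋Mmod (M≋ ea eb ec ed) = M≋mod (≋⇒≋mod ea) (≋⇒≋mod eb) (≋⇒≋mod ec) (≋⇒≋mod ed)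

  ≋Mmod-trans : {g h j : M2 p} → g ≋M h mod N → h ≋M j mod N → g ≋M j mod N
  ≋Mmod-trans (M≋mod ea eb ec ed) (M≋mod fa fb fc fd) =
    M≋mod (≋mod-trans ea fa) (≋mod-trans eb fb) (≋mod-trans ec fc) (≋mod-trans ed fd)

  ·-≋Mmod : {g g′ h h′ : M2 p} → g ≋M g′ mod N → h ≋M h′ mod N → g · h ≋M g′ · h′ mod N
  ·-≋Mmod (M≋mod ea eb ec ed) (M≋mod fa fb fc fd) =
    let a≡ = ≋mod-+ (≋mod-* ea fa) (≋mod-* eb fc) ; b≡ = ≋mod-+ (≋mod-* ea fb) (≋mod-* eb fd)
        c≡ = ≋mod-+ (≋mod-* ec fa) (≋mod-* ed fc) ; d≡ = ≋mod-+ (≋mod-* ec fb) (≋mod-* ed fd)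
    in M≋mod a≡ b≡ c≡ d≡

  ⁻¹-≋Mmod : {g h : M2 p} → g ≋M h mod N → g ⁻¹ ≋M h ⁻¹ mod N
  ⁻¹-≋Mmod (M≋mod ea eb ec ed) = M≋mod ed (≋mod-neg eb) (≋mod-neg ec) ea

  ≋Mmod-refl : {g : M2 p} → g ≋M g mod N
  ≋Mmod-refl = ≋M⇒≋Mmod ≋M-refl

module _ {p N : ℕ} where

  Γ-intro : (g : M2 p) → IsSL2 g → g ≋M I mod N → Γ p N g
  Γ-intro g sg (M≋mod ea eb ec ed) = sg , ≋mod⇒∣ₚ ea , ≋0⇒∣ₚ eb , ≋0⇒∣ₚ ec , ≋mod⇒∣ₚ ed

  Γ-elim : (g : M2 p) → Γ p N g → g ≋M I mod N
  Γ-elim g (_ , da , db , dc , dd) =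
    M≋mod (∣ₚ⇒≋mod (a g) 1ₚ da) (∣ₚ⇒≋0 (b g) db) (∣ₚ⇒≋0 (c g) dc) (∣ₚ⇒≋mod (d g) 1ₚ dd)

  Γ-SL : (g : M2 p) → Γ p N g → IsSL2 g
  Γ-SL g = proj₁

  Γ-resp : Respects p (Γ p N)
  Γ-resp g h g≈h γ = Γ-intro h (SL-resp e (Γ-SL g γ)) (≋Mmod-trans (≋M⇒≋Mmod (≋M-sym e)) (Γ-elim g γ))
    where e = ≈M⇒≋M g≈h

  Γ-one : HasOne p (Γ p N)
  Γ-one = Γ-intro I SL-I ≋Mmod-refl

  Γ-T : Γ p N (T^ N)
  Γ-T = Γ-intro (T^ N) (SL-intro (T^ N) (pw (λ k → det-T (+ N))))
                (M≋mod (≋⇒≋mod ≋-refl) (≋mod 1ₚ (pw (λ k → b-T (+ N)))) (≋⇒≋mod ≋-refl) (≋⇒≋mod ≋-refl))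
    where det-T : ∀ n → + 1 ℤ.* + 1 - n ℤ.* + 0 ≡ + 1
          det-T = solve-∀
          b-T : ∀ n → n - + 0 ≡ n ℤ.* + 1
          b-T = solve-∀

  Γ-mul : MulClosed p (Γ p N)
  Γ-mul g h γ η = Γ-intro (g · h) (SL-· g h (Γ-SL g γ) (Γ-SL h η))
    (≋Mmod-trans (·-≋Mmod (Γ-elim g γ) (Γ-elim h η)) (≋M⇒≋Mmod (·-identityʳ I)))

  Γ-inv : InvClosed p (Γ p N)
  Γ-inv g γ = Γ-intro (g ⁻¹) (SL-⁻¹ g (Γ-SL g γ))
    (≋Mmod-trans (⁻¹-≋Mmod (Γ-elim g γ)) (≋M⇒≋Mmod I⁻¹))

  Γ-conj : ConjClosed p (Γ p N)
  Γ-conj g h sg η = Γ-intro ((g · h) · g ⁻¹) (SL-· (g · h) (g ⁻¹) (SL-· g h sg (Γ-SL h η)) (SL-⁻¹ g sg))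
    (≋Mmod-trans {h = (g · I) · g ⁻¹} conjugate≡ (≋M⇒≋Mmod conjugate≈I))
    where
      conjugate≡ : (g · h) · g ⁻¹ ≋M (g · I) · g ⁻¹ mod N
      conjugate≡ = ·-≋Mmod {g = g · h} {g′ = g · I} {h = g ⁻¹} {h′ = g ⁻¹}
                     (·-≋Mmod {g = g} {g′ = g} {h = h} {h′ = I} ≋Mmod-refl (Γ-elim h η)) ≋Mmod-refl
      conjugate≈I : (g · I) · g ⁻¹ ≋M I
      conjugate≈I = ≋M-trans {h = g · g ⁻¹}
                      (·-cong {g = g · I} {g′ = g} {h = g ⁻¹} {h′ = g ⁻¹} (·-identityʳ g) ≋M-refl) (·-inverseʳ g sg)


module Cancellation {p : ℕ} (p-prime : Prime p) where

  instance
    p≢0 : NonZero p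
    p≢0 = prime⇒nonZero p-prime

  coprime-cancel : ∀ {m} → ¬ p ℕD.∣ m → ∀ k w → p ℕ.^ k ℕD.∣ m ℕ.* w → p ℕ.^ k ℕD.∣ w
  coprime-cancel p∤m zero w _ = ℕD.1∣ w
  coprime-cancel {m} p∤m (suc k) w pᵏ⁺¹∣mw
    with euclidsLemma m w p-prime (ℕD.∣-trans (ℕD.m∣m*n (p ℕ.^ k)) pᵏ⁺¹∣mw)
  ... | inj₁ p∣m = ⊥-elim (p∤m p∣m)
  ... | inj₂ (ℕD.divides q refl) =
    subst (p ℕ.^ suc k ℕD.∣_) (ℕP.*-comm p q) (ℕD.*-monoʳ-∣ p (coprime-cancel p∤m k q pᵏ∣mq))
    where
      pᵏ∣mq : p ℕ.^ k ℕD.∣ m ℕ.* q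
      pᵏ∣mq = ℕD.*-cancelˡ-∣ p (subst (p ℕ.* p ℕ.^ k ℕD.∣_)
                (trans (sym (ℕP.*-assoc m q p)) (ℕP.*-comm (m ℕ.* q) p)) pᵏ⁺¹∣mw)

  -- The p-adic valuation of a positive m is at most m, so p^j with m ≤ j can
  -- absorb every factor p of m.  (Induction on the valuation, with j as fuel.)
  power-cancel : ∀ j m .{{_ : NonZero m}} → m ≤ j → ∀ k w → p ℕ.^ (k ℕ.+ j) ℕD.∣ m ℕ.* w → p ℕ.^ k ℕD.∣ w
  power-cancel zero (suc m) () k w h
  power-cancel (suc j) m m≤j k w h with p ℕD.∣? m
  ... | no p∤m = coprime-cancel p∤m k w
                   (ℕD.∣-trans (ℕD.m∣m*n (p ℕ.^ suc j)) (subst (ℕD._∣ m ℕ.* w) (ℕP.^-distribˡ-+-* p k (suc j)) h))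
  ... | yes (ℕD.divides q refl) = power-cancel j q {{q≢0}} q≤j k w pᵏ⁺ʲ∣qw
    where
      q≢0 : NonZero q
      q≢0 = ℕP.m*n≢0⇒m≢0 q
      q≤j : q ≤ j
      q≤j = ℕP.≤-pred (ℕP.≤-trans (ℕP.m<m*n q p {{q≢0}} (nonTrivial⇒n>1 p {{prime⇒nonTrivial p-prime}})) m≤j)
      pᵏ⁺ʲ∣qw : p ℕ.^ (k ℕ.+ j) ℕD.∣ q ℕ.* w
      pᵏ⁺ʲ∣qw = ℕD.*-cancelˡ-∣ p (subst₂ (ℕD._∣_) (cong (p ℕ.^_) (ℕP.+-suc k j))
                  (trans (cong (ℕ._* w) (ℕP.*-comm q p)) (ℕP.*-assoc p q w)) h)
        where subst₂ : ∀ (R : ℕ → ℕ → Set) {x x′ y y′} → x ≡ x′ → y ≡ y′ → R x y → R x′ y′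
              subst₂ R refl refl r = r

  N-cancel : ∀ N .{{_ : NonZero N}} k {y y′} → + N ℤ.* y ≡ + N ℤ.* y′ mod P p (k ℕ.+ N) → y ≡ y′ mod P p k
  N-cancel N k {y} {y′} (mk-mod h) = mk-mod (∣ᵤ⇒∣ (power-cancel N N ℕP.≤-refl k ℤ.∣ y - y′ ∣
    (subst (p ℕ.^ (k ℕ.+ N) ℕD.∣_) (ℤP.abs-* (+ N) (y - y′)) (∣⇒∣ᵤ (subst (P p (k ℕ.+ N) ∣_) (factor (+ N) y y′) h)))))
    where factor : ∀ N y y′ → N ℤ.* y - N ℤ.* y′ ≡ N ℤ.* (y - y′)
          factor = solve-∀

_⟶ₚ_ : ∀ {p} → (ℕ → ℤp p) → ℤp p → Set
_⟶ₚ_ {p} xs x = ∀ k → ∃ λ n₀ → ∀ n → n₀ ≤ n → seq (xs n) k ≡ seq x k mod P p k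

infix 4 _⟶ₚ_

module Closedness {p : ℕ} (p-prime : Prime p) (N : ℕ) .{{_ : NonZero N}} where
  open Cancellation p-prime using (N-cancel)

  -- If xs n = N q(n) and xs → x, then the
  -- quotients q(n), read at level k + N for n large, form a coherent
  -- sequence Z, and x = N Z: dividing by N costs only the N extra levels.
  ∣ₚ-closed : (xs : ℕ → ℤp p) (x : ℤp p) → (∀ n → N ∣ₚ xs n) → xs ⟶ₚ x → N ∣ₚ x
  ∣ₚ-closed xs x divisible xs⟶x = mkℤp Z Z-coherent , λ k → divides-diff (x≡NZ k)
    where
      index : ℕ → ℕ
      index k = proj₁ (xs⟶x (k ℕ.+ N))
      q : ℕ → ℤp p
      q n = proj₁ (divisible n)
      Z : ℕ → ℤ
      Z k = seq (q (index k)) (k ℕ.+ N)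

      k≤k+N : ∀ k → k ≤ k ℕ.+ N
      k≤k+N k = ℕP.m≤m+n k N

      NZ≡x : ∀ k → + N ℤ.* Z k ≡ seq x (k ℕ.+ N) mod P p (k ℕ.+ N)
      NZ≡x k = begin
        + N ℤ.* Z k                          ≈⟨ mod-sym (mk-mod (proj₂ (divisible (index k)) (k ℕ.+ N))) ⟩
        seq (xs (index k)) (k ℕ.+ N)         ≈⟨ proj₂ (xs⟶x (k ℕ.+ N)) (index k) ℕP.≤-refl ⟩
        seq x (k ℕ.+ N)                      ∎
        where open SetoidReasoning (mod-setoid (P p (k ℕ.+ N)))

      quotients-agree : ∀ k → + N ℤ.* seq (q (index (suc k))) (k ℕ.+ N) ≡ + N ℤ.* Z k mod P p (k ℕ.+ N)
      quotients-agree k = begin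
        + N ℤ.* seq (q (index (suc k))) (k ℕ.+ N)
          ≈⟨ mod-*ˡ (+ N) (mod-sym (mk-mod (coh (q (index (suc k))) (k ℕ.+ N)))) ⟩
        + N ℤ.* Z (suc k)
          ≈⟨ mod-weaken (P-mono (ℕP.n≤1+n (k ℕ.+ N))) (NZ≡x (suc k)) ⟩
        seq x (suc (k ℕ.+ N))
          ≈⟨ mk-mod (coh x (k ℕ.+ N)) ⟩
        seq x (k ℕ.+ N)
          ≈⟨ mod-sym (NZ≡x k) ⟩
        + N ℤ.* Z k ∎
        where open SetoidReasoning (mod-setoid (P p (k ℕ.+ N)))

      Z-coherent : Coherent p Z
      Z-coherent k = divides-diff (begin
        Z (suc k)
          ≈⟨ mod-weaken (P-mono (k≤k+N k)) (mk-mod (coh (q (index (suc k))) (k ℕ.+ N))) ⟩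
        seq (q (index (suc k))) (k ℕ.+ N)
          ≈⟨ N-cancel N k (quotients-agree k) ⟩
        Z k ∎)
        where open SetoidReasoning (mod-setoid (P p k))

      x≡NZ : ∀ k → seq x k ≡ + N ℤ.* Z k mod P p k
      x≡NZ k = begin
        seq x k              ≈⟨ mod-sym (coh≤ x (k≤k+N k)) ⟩
        seq x (k ℕ.+ N)      ≈⟨ mod-weaken (P-mono (k≤k+N k)) (mod-sym (NZ≡x k)) ⟩
        + N ℤ.* Z k          ∎
        where open SetoidReasoning (mod-setoid (P p k))

module _ {p N : ℕ} (p-prime : Prime p) .{{_ : NonZero N}} where
  open Closedness p-prime N using (∣ₚ-closed)

  -- Γ(N) is closed: both SL₂ and each divisibility condition pass to limits,
  -- because the determinant and the entries are compatible with agreement at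
  -- a given level
  Γ-closed : Closed p (Γ p N)
  Γ-closed gs g inΓ gs⟶g =
    SL-limit ,
    closed-entry (λ h → a h -ₚ 1ₚ) (λ { (_ , da , _) → da }) (λ h h′ (ea , _) → mod-+ʳ (- + 1) (level (a h) (a h′) ea)) ,
    closed-entry b (λ { (_ , _ , db , _) → db }) (λ h h′ (_ , eb , _) → level (b h) (b h′) eb) ,
    closed-entry c (λ { (_ , _ , _ , dc , _) → dc }) (λ h h′ (_ , _ , ec , _) → level (c h) (c h′) ec) ,
    closed-entry (λ h → d h -ₚ 1ₚ) (λ { (_ , _ , _ , _ , dd) → dd }) (λ h h′ (_ , _ , _ , ed) → mod-+ʳ (- + 1) (level (d h) (d h′) ed))
    where
      index : ℕ → ℕ
      index k = proj₁ (gs⟶g k)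

      SL-limit : IsSL2 g
      SL-limit = SL-intro g (≋-intro (λ k →
        mod-trans (mod-sym (det-level (gs (index k)) g (proj₂ (gs⟶g k) (index k) ℕP.≤-refl)))
                  (at (SL-elim (gs (index k)) (Γ-SL {N = N} (gs (index k)) (inΓ (index k)))) k)))

      closed-entry : (f : M2 p → ℤp p) → (∀ {h} → Γ p N h → N ∣ₚ f h) →
                     (∀ {k} h h′ → EqMod k h h′ → seq (f h) k ≡ seq (f h′) k mod P p k) → N ∣ₚ f g
      closed-entry f f-divisible f-level = ∣ₚ-closed (λ n → f (gs n)) (f g) (λ n → f-divisible (inΓ n))
        (λ k → index k , λ n le → f-level (gs n) g (proj₂ (gs⟶g k) n le))

  Γ-closed-normal : IsClosedNormalSubgroup p (Γ p N)
  Γ-closed-normal = Γ-SL {N = N} , Γ-resp {N = N} , Γ-one {N = N} , Γ-mul {N = N} , Γ-inv {N = N} , Γ-conj {N = N} , Γ-closed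

geometric : ℤ → ℕ → ℤ
geometric t zero = + 0
geometric t (suc k) = + 1 ℤ.+ t ℤ.* geometric t k

geometric-sum : ∀ t k → (+ 1 - t) ℤ.* geometric t k ≡ + 1 - t ℤ.^ k
geometric-sum t zero = identity t
  where identity : ∀ t → (+ 1 - t) ℤ.* + 0 ≡ + 1 - + 1
        identity = solve-∀
geometric-sum t (suc k) = begin
  (+ 1 - t) ℤ.* (+ 1 ℤ.+ t ℤ.* geometric t k)      ≡⟨ expand t (geometric t k) ⟩
  (+ 1 - t) ℤ.+ t ℤ.* ((+ 1 - t) ℤ.* geometric t k) ≡⟨ cong (λ s → (+ 1 - t) ℤ.+ t ℤ.* s) (geometric-sum t k) ⟩
  (+ 1 - t) ℤ.+ t ℤ.* (+ 1 - t ℤ.^ k)              ≡⟨ collect t (t ℤ.^ k) ⟩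
  + 1 - t ℤ.* t ℤ.^ k                               ∎
  where open Eq.≡-Reasoning
        expand : ∀ t G → (+ 1 - t) ℤ.* (+ 1 ℤ.+ t ℤ.* G) ≡ (+ 1 - t) ℤ.+ t ℤ.* ((+ 1 - t) ℤ.* G)
        expand = solve-∀
        collect : ∀ t s → (+ 1 - t) ℤ.+ t ℤ.* (+ 1 - s) ≡ + 1 - t ℤ.* s
        collect = solve-∀

module Units {p : ℕ} (p-prime : Prime p) where

  P1∣p : P p 1 ∣ + p
  P1∣p = ∣⇒P1∣ (+ p) ℕD.∣-refl

  inverse-mod-pℕ : (n : ℕ) → ¬ p ℕD.∣ n → Σ ℤ λ v → + n ℤ.* v ≡ + 1 mod + p
  inverse-mod-pℕ n p∤n with coprime-Bézout p-coprime-n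
    where p-coprime-n : Coprime p n
          p-coprime-n {d} (d∣p , d∣n) with prime⇒irreducible p-prime d∣p
          ... | inj₁ d≡1 = d≡1
          ... | inj₂ refl = ⊥-elim (p∤n d∣n)
  ... | Bézout.+- x y eq = - + y , mk-mod (divides (- + x) (begin
        + n ℤ.* (- + y) - + 1      ≡⟨ negate (+ n) (+ y) ⟩
        - (+ 1 ℤ.+ + y ℤ.* + n)    ≡⟨ cong (λ s → - (+ 1 ℤ.+ s)) (sym (ℤP.pos-* y n)) ⟩
        - + (1 ℕ.+ y ℕ.* n)        ≡⟨ cong (λ s → - + s) eq ⟩
        - + (x ℕ.* p)              ≡⟨ cong -_ (ℤP.pos-* x p) ⟩
        - (+ x ℤ.* + p)            ≡⟨ ℤP.neg-distribˡ-* (+ x) (+ p) ⟩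
        - + x ℤ.* + p              ∎))
    where open Eq.≡-Reasoning
          negate : ∀ n y → n ℤ.* (- y) - + 1 ≡ - (+ 1 ℤ.+ y ℤ.* n)
          negate = solve-∀
  ... | Bézout.-+ x y eq = + y , mk-mod (divides (+ x) (begin
        + n ℤ.* + y - + 1          ≡⟨ cong (_- + 1) (ℤP.*-comm (+ n) (+ y)) ⟩
        + y ℤ.* + n - + 1          ≡⟨ cong (_- + 1) (sym (ℤP.pos-* y n)) ⟩
        + (y ℕ.* n) - + 1          ≡⟨ cong (λ s → + s - + 1) (sym eq) ⟩
        + (1 ℕ.+ x ℕ.* p) - + 1    ≡⟨ cong (λ s → (+ 1 ℤ.+ s) - + 1) (ℤP.pos-* x p) ⟩
        (+ 1 ℤ.+ + x ℤ.* + p) - + 1 ≡⟨ cancel (+ x ℤ.* + p) ⟩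
        + x ℤ.* + p                ∎))
    where open Eq.≡-Reasoning
          cancel : ∀ s → (+ 1 ℤ.+ s) - + 1 ≡ s
          cancel = solve-∀

  inverse-mod-p : (z : ℤ) → ¬ (P p 1 ∣ z) → Σ ℤ λ v → z ℤ.* v ≡ + 1 mod P p 1
  inverse-mod-p (+ n) P1∤z with inverse-mod-pℕ n (λ p∣n → P1∤z (∣⇒P1∣ (+ n) p∣n))
  ... | v , nv≡1 = v , mod-weaken P1∣p nv≡1
  inverse-mod-p -[1+ m ] P1∤z with inverse-mod-pℕ (suc m) (λ p∣n → P1∤z (∣⇒P1∣ -[1+ m ] p∣n))
  ... | v , nv≡1 = - v , mod-weaken P1∣p (subst (_≡ + 1 mod + p) (sign-swap (+ suc m) v) nv≡1)
    where sign-swap : ∀ n v → n ℤ.* v ≡ (- n) ℤ.* (- v)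
          sign-swap = solve-∀

  power-divisible : ∀ {t} → P p 1 ∣ t → ∀ k → P p k ∣ t ℤ.^ k
  power-divisible P1∣t zero = ∣-refl
  power-divisible {t} P1∣t (suc k) = ∣ᵤ⇒∣ (subst (p ℕ.* p ℕ.^ k ℕD.∣_) (sym (ℤP.abs-* t (t ℤ.^ k)))
    (ℕD.*-pres-∣ (P1∣⇒∣ p P1∣t) (∣⇒∣ᵤ (power-divisible P1∣t k))))

  -- With v an
  -- inverse of x₁ modulo p, put t_k = 1 - x_k v (divisible by p); then
  -- u_k = v (1 + t_k + ⋯ + t_k^(k-1)) satisfies x_k u_k = 1 - t_k^k ≡ 1 mod p^k,
  -- and the u_k are coherent because inverses modulo p^k are unique.
  unit-inverse : (x : ℤp p) → ¬ (P p 1 ∣ seq x 1) → Σ (ℤp p) λ u → x *ₚ u ≋ 1ₚ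
  unit-inverse x P1∤x₁ = mkℤp u u-coherent , ≋-intro inverse-at
    where
      v : ℤ
      v = proj₁ (inverse-mod-p (seq x 1) P1∤x₁)
      t : ℕ → ℤ
      t k = + 1 - seq x k ℤ.* v
      u : ℕ → ℤ
      u k = v ℤ.* geometric (t k) k

      t-divisible : ∀ k → P p 1 ∣ t (suc k)
      t-divisible k = ≡0⇒∣ (begin
        + 1 - seq x (suc k) ℤ.* v   ≈⟨ mod-sub (+ 1) (mod-*ʳ v (coh≤ x (s≤s z≤n))) ⟩
        + 1 - seq x 1 ℤ.* v         ≈⟨ mod-sub (+ 1) (proj₂ (inverse-mod-p (seq x 1) P1∤x₁)) ⟩
        + 1 - + 1                   ≡⟨⟩
        + 0                         ∎)
        where open SetoidReasoning (mod-setoid (P p 1))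

      inverse-at : ∀ k → seq x k ℤ.* u k ≡ + 1 mod P p k
      inverse-at zero = mod-one
      inverse-at (suc k) = begin
        seq x (suc k) ℤ.* u (suc k)          ≡⟨ regroup (seq x (suc k)) v (geometric (t (suc k)) (suc k)) ⟩
        (+ 1 - t (suc k)) ℤ.* geometric (t (suc k)) (suc k)
                                             ≡⟨ geometric-sum (t (suc k)) (suc k) ⟩
        + 1 - t (suc k) ℤ.^ suc k            ≈⟨ mod-sub (+ 1) (∣⇒≡0 (power-divisible (t-divisible k) (suc k))) ⟩
        + 1 - + 0                            ≡⟨⟩
        + 1                                  ∎
        where open SetoidReasoning (mod-setoid (P p (suc k)))
              regroup : ∀ x v G → x ℤ.* (v ℤ.* G) ≡ (+ 1 - (+ 1 - x ℤ.* v)) ℤ.* G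
              regroup = solve-∀

      u-coherent : Coherent p u
      u-coherent k = divides-diff (inverses-agree {x = seq x (suc k)} {x′ = seq x k} {u = u (suc k)} {u′ = u k}
        (mod-weaken (P-mono (ℕP.n≤1+n k)) (inverse-at (suc k))) (inverse-at k) (mk-mod (coh x k)))

module _ {p : ℕ} where

  U L : ℤp p → M2 p
  U x = mat 1ₚ x 0ₚ 1ₚ
  L y = mat 1ₚ 0ₚ y 1ₚ

  S : M2 p
  S = mat 0ₚ 1ₚ (-ₚ 1ₚ) 0ₚ

  V : ℤp p → M2 p
  V x = (L 1ₚ · U x) · L 1ₚ ⁻¹

  SL-S : IsSL2 S
  SL-S = SL-intro S (pw (λ k → refl))

  SL-L : (y : ℤp p) → IsSL2 (L y)
  SL-L y = SL-intro (L y) (pw (λ k → identity (seq y k)))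
    where identity : ∀ Y → + 1 ℤ.* + 1 - + 0 ℤ.* Y ≡ + 1
          identity = solve-∀

  U-cong : {x y : ℤp p} → x ≋ y → U x ≋M U y
  U-cong e = M≋ ≋-refl e ≋-refl ≋-refl

  U-+ : (x y : ℤp p) → U x · U y ≋M U (x +ₚ y)
  U-+ x y = M≋ (pw (λ k → one (seq x k))) (pw (λ k → add (seq x k) (seq y k)))
               (pw (λ k → vanish (seq y k))) (pw (λ k → one′ (seq y k)))
    where one : ∀ X → + 1 ℤ.* + 1 ℤ.+ X ℤ.* + 0 ≡ + 1
          one = solve-∀
          add : ∀ X Y → + 1 ℤ.* Y ℤ.+ X ℤ.* + 1 ≡ X ℤ.+ Y
          add = solve-∀
          vanish : ∀ Y → + 0 ℤ.* + 1 ℤ.+ + 1 ℤ.* + 0 ≡ + 0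
          vanish = solve-∀
          one′ : ∀ Y → + 0 ℤ.* Y ℤ.+ + 1 ℤ.* + 1 ≡ + 1
          one′ = solve-∀

  U-⁻¹ : (x : ℤp p) → U x ⁻¹ ≋M U (-ₚ x)
  U-⁻¹ x = M≋ ≋-refl ≋-refl (pw (λ k → refl)) ≋-refl

  S-conj : (y : ℤp p) → (S · U (-ₚ y)) · S ⁻¹ ≋M L y
  S-conj y = M≋ (pw (λ k → diagonal (seq y k))) (pw (λ k → vanish (seq y k)))
                (pw (λ k → corner (seq y k))) (pw (λ k → diagonal′ (seq y k)))
    where
      diagonal : ∀ Y → (+ 0 ℤ.* + 1 ℤ.+ + 1 ℤ.* + 0) ℤ.* + 0 ℤ.+ (+ 0 ℤ.* (- Y) ℤ.+ + 1 ℤ.* + 1) ℤ.* (- (- (+ 1))) ≡ + 1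
      diagonal = solve-∀
      vanish : ∀ Y → (+ 0 ℤ.* + 1 ℤ.+ + 1 ℤ.* + 0) ℤ.* (- (+ 1)) ℤ.+ (+ 0 ℤ.* (- Y) ℤ.+ + 1 ℤ.* + 1) ℤ.* + 0 ≡ + 0
      vanish = solve-∀
      corner : ∀ Y → ((- (+ 1)) ℤ.* + 1 ℤ.+ + 0 ℤ.* + 0) ℤ.* + 0 ℤ.+ ((- (+ 1)) ℤ.* (- Y) ℤ.+ + 0 ℤ.* + 1) ℤ.* (- (- (+ 1))) ≡ Y
      corner = solve-∀
      diagonal′ : ∀ Y → ((- (+ 1)) ℤ.* + 1 ℤ.+ + 0 ℤ.* + 0) ℤ.* (- (+ 1)) ℤ.+ ((- (+ 1)) ℤ.* (- Y) ℤ.+ + 0 ℤ.* + 1) ℤ.* + 0 ≡ + 1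
      diagonal′ = solve-∀

  V-matrix : ℤp p → M2 p
  V-matrix x = mat (1ₚ -ₚ x) x (-ₚ x) (1ₚ +ₚ x)

  V-explicit : (x : ℤp p) → V x ≋M V-matrix x
  V-explicit x = M≋ (pw (λ k → ca (seq x k))) (pw (λ k → cb (seq x k)))
                    (pw (λ k → cc (seq x k))) (pw (λ k → cd (seq x k)))
    where
      ca : ∀ X → (+ 1 ℤ.* + 1 ℤ.+ + 0 ℤ.* + 0) ℤ.* + 1 ℤ.+ (+ 1 ℤ.* X ℤ.+ + 0 ℤ.* + 1) ℤ.* (- (+ 1)) ≡ + 1 - X
      ca = solve-∀
      cb : ∀ X → (+ 1 ℤ.* + 1 ℤ.+ + 0 ℤ.* + 0) ℤ.* (- (+ 0)) ℤ.+ (+ 1 ℤ.* X ℤ.+ + 0 ℤ.* + 1) ℤ.* + 1 ≡ X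
      cb = solve-∀
      cc : ∀ X → (+ 1 ℤ.* + 1 ℤ.+ + 1 ℤ.* + 0) ℤ.* + 1 ℤ.+ (+ 1 ℤ.* X ℤ.+ + 1 ℤ.* + 1) ℤ.* (- (+ 1)) ≡ - X
      cc = solve-∀
      cd : ∀ X → (+ 1 ℤ.* + 1 ℤ.+ + 1 ℤ.* + 0) ℤ.* (- (+ 0)) ℤ.+ (+ 1 ℤ.* X ℤ.+ + 1 ℤ.* + 1) ℤ.* + 1 ≡ + 1 ℤ.+ X
      cd = solve-∀

  -- An SL₂ matrix whose entry a is invertible is determined by a, b and c,
  -- since then d = u (a d) = u (1 + b c).
  SL-determined : (g h : M2 p) (u : ℤp p) → IsSL2 g → IsSL2 h →
                  a g ≋ a h → b g ≋ b h → c g ≋ c h → a g *ₚ u ≋ 1ₚ → d g ≋ d h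
  SL-determined g h u sg sh ea eb ec au≡1 = ≋-intro λ k → let open SetoidReasoning (mod-setoid (P p k)) in
    begin
      D k                                   ≡⟨ sym (ℤP.*-identityˡ (D k)) ⟩
      + 1 ℤ.* D k                           ≈⟨ mod-*ʳ (D k) (mod-sym (at au≡1 k)) ⟩
      (A k ℤ.* uₖ k) ℤ.* D k                ≡⟨ expand (A k) (B k) (C k) (D k) (uₖ k) ⟩
      uₖ k ℤ.* (A k ℤ.* D k - B k ℤ.* C k) ℤ.+ uₖ k ℤ.* (B k ℤ.* C k)
        ≈⟨ mod-+ (mod-*ˡ (uₖ k) (at (SL-elim g sg) k)) (mod-*ˡ (uₖ k) (mod-* (at eb k) (at ec k))) ⟩
      uₖ k ℤ.* + 1 ℤ.+ uₖ k ℤ.* (B′ k ℤ.* C′ k)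
        ≈⟨ mod-sym (mod-+ʳ (uₖ k ℤ.* (B′ k ℤ.* C′ k)) (mod-*ˡ (uₖ k) (at (SL-elim h sh) k))) ⟩
      uₖ k ℤ.* (A′ k ℤ.* D′ k - B′ k ℤ.* C′ k) ℤ.+ uₖ k ℤ.* (B′ k ℤ.* C′ k)
                                            ≡⟨ contract (A′ k) (B′ k) (C′ k) (D′ k) (uₖ k) ⟩
      (A′ k ℤ.* uₖ k) ℤ.* D′ k              ≈⟨ mod-*ʳ (D′ k) (mod-*ʳ (uₖ k) (mod-sym (at ea k))) ⟩
      (A k ℤ.* uₖ k) ℤ.* D′ k               ≈⟨ mod-*ʳ (D′ k) (at au≡1 k) ⟩
      + 1 ℤ.* D′ k                          ≡⟨ ℤP.*-identityˡ (D′ k) ⟩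
      D′ k                                  ∎
    where
      A B C D A′ B′ C′ D′ uₖ : ℕ → ℤ
      A = seq (a g) ; B = seq (b g) ; C = seq (c g) ; D = seq (d g)
      A′ = seq (a h) ; B′ = seq (b h) ; C′ = seq (c h) ; D′ = seq (d h) ; uₖ = seq u
      expand : ∀ A B C D U → (A ℤ.* U) ℤ.* D ≡ U ℤ.* (A ℤ.* D - B ℤ.* C) ℤ.+ U ℤ.* (B ℤ.* C)
      expand = solve-∀
      contract : ∀ A B C D U → U ℤ.* (A ℤ.* D - B ℤ.* C) ℤ.+ U ℤ.* (B ℤ.* C) ≡ (A ℤ.* U) ℤ.* D
      contract = solve-∀

  SL-U : (x : ℤp p) → IsSL2 (U x)
  SL-U x = SL-intro (U x) (pw (λ k → identity (seq x k)))
    where identity : ∀ X → + 1 ℤ.* + 1 - X ℤ.* + 0 ≡ + 1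
          identity = solve-∀

  SL-V : (x : ℤp p) → IsSL2 (V x)
  SL-V x = SL-· (L 1ₚ · U x) (L 1ₚ ⁻¹) (SL-· (L 1ₚ) (U x) (SL-L 1ₚ) (SL-U x)) (SL-⁻¹ (L 1ₚ) (SL-L 1ₚ))

  shift : M2 p → ℤp p
  shift g = 1ₚ -ₚ a g

  lower-part upper-part : M2 p → ℤp p → ℤp p
  lower-part g u = (c g +ₚ shift g) *ₚ u
  upper-part g u = (b g -ₚ shift g) *ₚ u

  factors : M2 p → ℤp p → M2 p
  factors g u = (L (lower-part g u) · V (shift g)) · U (upper-part g u)

  factorisation : (g : M2 p) (u : ℤp p) → IsSL2 g → a g *ₚ u ≋ 1ₚ → factors g u ≋M g
  factorisation g u sg au≡1 = ≋M-trans {h = explicit} factors≈explicit explicit≈g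
    where
      explicit : M2 p
      explicit = (L (lower-part g u) · V-matrix (shift g)) · U (upper-part g u)

      factors≈explicit : factors g u ≋M explicit
      factors≈explicit =
        ·-cong {g = L (lower-part g u) · V (shift g)} {g′ = L (lower-part g u) · V-matrix (shift g)}
               {h = U (upper-part g u)} {h′ = U (upper-part g u)}
          (·-cong {g = L (lower-part g u)} {g′ = L (lower-part g u)} {h = V (shift g)} {h′ = V-matrix (shift g)}
                  ≋M-refl (V-explicit (shift g)))
          ≋M-refl

      A B C uₖ : ℕ → ℤ
      A = seq (a g) ; B = seq (b g) ; C = seq (c g) ; uₖ = seq u

      ea : a explicit ≋ a g
      ea = pw (λ k → identity (A k) (C k) (uₖ k))
        where identity : ∀ A C U →
                (+ 1 ℤ.* (+ 1 - (+ 1 - A)) ℤ.+ + 0 ℤ.* (- (+ 1 - A))) ℤ.* + 1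
                ℤ.+ (+ 1 ℤ.* (+ 1 - A) ℤ.+ + 0 ℤ.* (+ 1 ℤ.+ (+ 1 - A))) ℤ.* + 0 ≡ A
              identity = solve-∀

      eb : b explicit ≋ b g
      eb = ≋-intro λ k → let open SetoidReasoning (mod-setoid (P p k)) in begin
        seq (b explicit) k
          ≡⟨ expand (A k) (B k) (uₖ k) ⟩
        (A k ℤ.* uₖ k) ℤ.* (B k - (+ 1 - A k)) ℤ.+ (+ 1 - A k)
          ≈⟨ mod-+ʳ (+ 1 - A k) (mod-*ʳ (B k - (+ 1 - A k)) (at au≡1 k)) ⟩
        + 1 ℤ.* (B k - (+ 1 - A k)) ℤ.+ (+ 1 - A k)
          ≡⟨ contract (A k) (B k) ⟩
        B k ∎
        where expand : ∀ A B U →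
                (+ 1 ℤ.* (+ 1 - (+ 1 - A)) ℤ.+ + 0 ℤ.* (- (+ 1 - A))) ℤ.* ((B - (+ 1 - A)) ℤ.* U)
                ℤ.+ (+ 1 ℤ.* (+ 1 - A) ℤ.+ + 0 ℤ.* (+ 1 ℤ.+ (+ 1 - A))) ℤ.* + 1
                ≡ (A ℤ.* U) ℤ.* (B - (+ 1 - A)) ℤ.+ (+ 1 - A)
              expand = solve-∀
              contract : ∀ A B → + 1 ℤ.* (B - (+ 1 - A)) ℤ.+ (+ 1 - A) ≡ B
              contract = solve-∀

      ec : c explicit ≋ c g
      ec = ≋-intro λ k → let open SetoidReasoning (mod-setoid (P p k)) in begin
        seq (c explicit) k
          ≡⟨ expand (A k) (C k) (uₖ k) ⟩
        (A k ℤ.* uₖ k) ℤ.* (C k ℤ.+ (+ 1 - A k)) - (+ 1 - A k)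
          ≈⟨ mod-+ʳ (- (+ 1 - A k)) (mod-*ʳ (C k ℤ.+ (+ 1 - A k)) (at au≡1 k)) ⟩
        + 1 ℤ.* (C k ℤ.+ (+ 1 - A k)) - (+ 1 - A k)
          ≡⟨ contract (A k) (C k) ⟩
        C k ∎
        where expand : ∀ A C U →
                (((C ℤ.+ (+ 1 - A)) ℤ.* U) ℤ.* (+ 1 - (+ 1 - A)) ℤ.+ + 1 ℤ.* (- (+ 1 - A))) ℤ.* + 1
                ℤ.+ (((C ℤ.+ (+ 1 - A)) ℤ.* U) ℤ.* (+ 1 - A) ℤ.+ + 1 ℤ.* (+ 1 ℤ.+ (+ 1 - A))) ℤ.* + 0
                ≡ (A ℤ.* U) ℤ.* (C ℤ.+ (+ 1 - A)) - (+ 1 - A)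
              expand = solve-∀
              contract : ∀ A C → + 1 ℤ.* (C ℤ.+ (+ 1 - A)) - (+ 1 - A) ≡ C
              contract = solve-∀

      SL-explicit : IsSL2 explicit
      SL-explicit = SL-resp {g = factors g u} {h = explicit} factors≈explicit
        (SL-· (L (lower-part g u) · V (shift g)) (U (upper-part g u))
              (SL-· (L (lower-part g u)) (V (shift g)) (SL-L (lower-part g u)) (SL-V (shift g)))
              (SL-U (upper-part g u)))

      explicit≈g : explicit ≋M g
      explicit≈g = M≋ ea eb ec
        (let au≋ = *-cong ea (≋-refl {x = u}) in SL-determined explicit g u SL-explicit sg ea eb ec (≋-trans au≋ au≡1))

module _ {p N : ℕ} (p-prime : Prime p) where

  1≢0-mod-p : ¬ (+ 1 ≡ + 0 mod P p 1)
  1≢0-mod-p 1≡0 = ℕP.<-irrefl (sym (ℕD.∣1⇒≡1 (P1∣⇒∣ p (≡0⇒∣ 1≡0))))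
                              (nonTrivial⇒n>1 p {{prime⇒nonTrivial p-prime}})

  -- If p divides the entry a of g ∈ Γ(N), then it does not divide the entry
  -- a + N c of T^N g: otherwise p divides N c, but p ∣ N contradicts a ≡ 1
  -- mod N, and p ∣ c contradicts det g = 1.
  unit-after-T : (g : M2 p) → Γ p N g → P p 1 ∣ seq (a g) 1 → ¬ (P p 1 ∣ seq (a (T^ N · g)) 1)
  unit-after-T g γ p∣a p∣a+Nc = [ p∤N , p∤c ]′ (euclidsLemma N ℤ.∣ c₁ ∣ p-prime p∣N·c)
    where
      a₁ b₁ c₁ d₁ : ℤ
      a₁ = seq (a g) 1 ; b₁ = seq (b g) 1 ; c₁ = seq (c g) 1 ; d₁ = seq (d g) 1
      open SetoidReasoning (mod-setoid (P p 1))

      a≡0 : a₁ ≡ + 0 mod P p 1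
      a≡0 = ∣⇒≡0 p∣a

      N·c≡0 : + N ℤ.* c₁ ≡ + 0 mod P p 1
      N·c≡0 = begin
        + N ℤ.* c₁                             ≡⟨ isolate a₁ (+ N) c₁ ⟩
        (+ 1 ℤ.* a₁ ℤ.+ + N ℤ.* c₁) - a₁      ≈⟨ mod-+ (∣⇒≡0 p∣a+Nc) (mod-neg a≡0) ⟩
        + 0 - + 0                              ≡⟨⟩
        + 0                                    ∎
        where isolate : ∀ a N c → N ℤ.* c ≡ (+ 1 ℤ.* a ℤ.+ N ℤ.* c) - a
              isolate = solve-∀

      p∣N·c : p ℕD.∣ N ℕ.* ℤ.∣ c₁ ∣
      p∣N·c = subst (p ℕD.∣_) (ℤP.abs-* (+ N) c₁) (P1∣⇒∣ p (≡0⇒∣ N·c≡0))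

      p∤N : ¬ p ℕD.∣ N
      p∤N p∣N = 1≢0-mod-p (begin
        + 1                     ≡⟨ reconstruct a₁ ⟩
        a₁ - (a₁ - + 1)         ≈⟨ mod-sub a₁ (at (multiple a≡1) 1) ⟩
        a₁ - + N ℤ.* z          ≈⟨ mod-+ a≡0 (mod-neg (mod-*ʳ z (∣⇒≡0 (∣⇒P1∣ (+ N) p∣N)))) ⟩
        + 0 - + 0 ℤ.* z         ≡⟨ vanish z ⟩
        + 0                     ∎)
        where
          a≡1 : a g ≋ 1ₚ mod N
          a≡1 = ≋a-mod (Γ-elim {N = N} g γ)
          z : ℤ
          z = seq (quotient a≡1) 1
          reconstruct : ∀ a → + 1 ≡ a - (a - + 1)
          reconstruct = solve-∀
          vanish : ∀ z → + 0 - + 0 ℤ.* z ≡ + 0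
          vanish = solve-∀

      p∤c : ¬ p ℕD.∣ ℤ.∣ c₁ ∣
      p∤c p∣c = 1≢0-mod-p (begin
        + 1                       ≈⟨ mod-sym (at (SL-elim g (Γ-SL {N = N} g γ)) 1) ⟩
        a₁ ℤ.* d₁ - b₁ ℤ.* c₁     ≈⟨ mod-+ (mod-*ʳ d₁ a≡0) (mod-neg (mod-*ˡ b₁ (∣⇒≡0 (∣⇒P1∣ c₁ p∣c)))) ⟩
        + 0 ℤ.* d₁ - b₁ ℤ.* + 0   ≡⟨ vanish b₁ d₁ ⟩
        + 0                       ∎)
        where vanish : ∀ b d → + 0 ℤ.* d - b ℤ.* + 0 ≡ + 0
              vanish = solve-∀

module Minimality {p N : ℕ} (p-prime : Prime p) (H : M2 p → Set) (H-cns : IsClosedNormalSubgroup p H) (H-T : H (T^ N)) where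

  open Units p-prime using (unit-inverse)

  private
    H-resp : Respects p H
    H-resp = proj₁ (proj₂ H-cns)
    H-one : HasOne p H
    H-one = proj₁ (proj₂ (proj₂ H-cns))
    H-mul : MulClosed p H
    H-mul = proj₁ (proj₂ (proj₂ (proj₂ H-cns)))
    H-inv : InvClosed p H
    H-inv = proj₁ (proj₂ (proj₂ (proj₂ (proj₂ H-cns))))
    H-conj : ConjClosed p H
    H-conj = proj₁ (proj₂ (proj₂ (proj₂ (proj₂ (proj₂ H-cns)))))
    H-closed : Closed p H
    H-closed = proj₂ (proj₂ (proj₂ (proj₂ (proj₂ (proj₂ H-cns)))))

  H-≋ : (g h : M2 p) → g ≋M h → H g → H h
  H-≋ g h e = H-resp g h (≋M⇒≈M e)

  U-ℕ-multiples : (x : ℤp p) → H (U x) → ∀ m → H (U (ι (+ m) *ₚ x))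
  U-ℕ-multiples x Hx zero = H-≋ I (U (ι (+ 0) *ₚ x)) (U-cong (pw (λ k → zero* (seq x k)))) H-one
    where zero* : ∀ X → + 0 ≡ + 0 ℤ.* X
          zero* = solve-∀
  U-ℕ-multiples x Hx (suc m) =
    H-≋ (U (ι (+ m) *ₚ x) · U x) (U (ι (+ suc m) *ₚ x))
        (≋M-trans {h = U (ι (+ m) *ₚ x +ₚ x)} (U-+ (ι (+ m) *ₚ x) x) (U-cong (pw (λ k → succ* (+ m) (seq x k)))))
        (H-mul (U (ι (+ m) *ₚ x)) (U x) (U-ℕ-multiples x Hx m) Hx)
    where succ* : ∀ m X → m ℤ.* X ℤ.+ X ≡ (+ 1 ℤ.+ m) ℤ.* X
          succ* = solve-∀

  U-ℤ-multiples : (x : ℤp p) → H (U x) → ∀ t → H (U (ι t *ₚ x))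
  U-ℤ-multiples x Hx (+ m) = U-ℕ-multiples x Hx m
  U-ℤ-multiples x Hx -[1+ m ] =
    H-≋ (U (ι (+ suc m) *ₚ x) ⁻¹) (U (ι -[1+ m ] *ₚ x))
        (≋M-trans {h = U (-ₚ (ι (+ suc m) *ₚ x))} (U-⁻¹ (ι (+ suc m) *ₚ x)) (U-cong (pw (λ k → neg* (+ suc m) (seq x k)))))
        (H-inv (U (ι (+ suc m) *ₚ x)) (U-ℕ-multiples x Hx (suc m)))
    where neg* : ∀ m X → - (m ℤ.* X) ≡ (- m) ℤ.* X
          neg* = solve-∀

  -- ... and, being closed, all its ℤ_p-multiples: U (y x) is the limit of
  -- U (y_n x) where y_n ∈ ℤ are the levels of y
  U-ℤp-multiples : (x : ℤp p) → H (U x) → ∀ y → H (U (y *ₚ x))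
  U-ℤp-multiples x Hx y = H-closed (λ n → U (ι (seq y n) *ₚ x)) (U (y *ₚ x))
    (λ n → U-ℤ-multiples x Hx (seq y n))
    (λ k → k , λ n k≤n → divides-diff (mod-refl {x = + 1}) , divides-diff (mod-*ʳ (seq x k) (coh≤ y k≤n))
                        , divides-diff (mod-refl {x = + 0}) , divides-diff (mod-refl {x = + 1}))

  H-U : {t : ℤp p} → t ≋ 0ₚ mod N → H (U t)
  H-U {t} (≋mod q t≈Nq) = H-≋ (U (q *ₚ ι (+ N))) (U t) (U-cong q·N≈t) (U-ℤp-multiples (ι (+ N)) H-T q)
    where q·N≈t : q *ₚ ι (+ N) ≋ t
          q·N≈t = ≋-trans (pw (λ k → comm (seq q k) (+ N)))
                    (≋-trans (≋-sym t≈Nq) (pw (λ k → minus-zero (seq t k))))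
            where comm : ∀ Q N → Q ℤ.* N ≡ N ℤ.* Q
                  comm = solve-∀
                  minus-zero : ∀ X → X ℤ.+ - (+ 0) ≡ X
                  minus-zero = solve-∀

  H-L : {t : ℤp p} → t ≋ 0ₚ mod N → H (L t)
  H-L {t} t≡0 = H-≋ ((S · U (-ₚ t)) · S ⁻¹) (L t) (S-conj t)
    (H-conj S (U (-ₚ t)) SL-S (H-U (≋mod-trans {y = -ₚ 0ₚ} (≋mod-neg t≡0) (≋⇒≋mod (pw (λ k → refl))))))

  H-V : {t : ℤp p} → t ≋ 0ₚ mod N → H (V t)
  H-V {t} t≡0 = H-conj (L 1ₚ) (U t) (SL-L 1ₚ) (H-U t≡0)

  -- Every g ∈ Γ(N) with invertible entry a lies in H: its unipotent factors
  -- L, V and U all have parameters divisible by N.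
  H-Γ-unit : (g : M2 p) → Γ p N g → (u : ℤp p) → a g *ₚ u ≋ 1ₚ → H g
  H-Γ-unit g γ u au≡1 = H-≋ (factors g u) g (factorisation g u (Γ-SL {N = N} g γ) au≡1)
    (H-mul (L (lower-part g u) · V (shift g)) (U (upper-part g u))
       (H-mul (L (lower-part g u)) (V (shift g)) (H-L lower≡0) (H-V shift≡0)) (H-U upper≡0))
    where
      g≡I : g ≋M I mod N
      g≡I = Γ-elim g γ

      shift≡0 : shift g ≋ 0ₚ mod N
      shift≡0 = let step = ≋mod-+ (≋⇒≋mod (≋-refl {x = 1ₚ})) (≋mod-neg (≋a-mod g≡I)) in
        ≋mod-trans step (≋⇒≋mod (pw (λ k → refl)))

      lower≡0 : lower-part g u ≋ 0ₚ mod N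
      lower≡0 = let step = ≋mod-* (≋mod-+ (≋c-mod g≡I) shift≡0) (≋⇒≋mod (≋-refl {x = u})) in
        ≋mod-trans step (≋⇒≋mod (pw (λ k → zero* (seq u k))))
        where zero* : ∀ U → (+ 0 ℤ.+ + 0) ℤ.* U ≡ + 0
              zero* = solve-∀

      upper≡0 : upper-part g u ≋ 0ₚ mod N
      upper≡0 = let step = ≋mod-* (≋mod-+ (≋b-mod g≡I) (≋mod-neg shift≡0)) (≋⇒≋mod (≋-refl {x = u})) in
        ≋mod-trans step (≋⇒≋mod (pw (λ k → zero* (seq u k))))
        where zero* : ∀ U → (+ 0 ℤ.+ - (+ 0)) ℤ.* U ≡ + 0
              zero* = solve-∀

  H-Γ-p∤a : (g : M2 p) → Γ p N g → ¬ (P p 1 ∣ seq (a g) 1) → H g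
  H-Γ-p∤a g γ p∤a = H-Γ-unit g γ (proj₁ (unit-inverse (a g) p∤a)) (proj₂ (unit-inverse (a g) p∤a))

  Γ⊆H : (g : M2 p) → Γ p N g → H g
  Γ⊆H g γ = by-cases (P p 1 ∣? seq (a g) 1)
    where
      by-cases : Dec (P p 1 ∣ seq (a g) 1) → H g
      by-cases (no p∤a) = H-Γ-p∤a g γ p∤a
      by-cases (yes p∣a) = H-≋ (T^ N ⁻¹ · (T^ N · g)) g (⁻¹-cancelˡ (T^ N) g (Γ-SL {N = N} (T^ N) (Γ-T {N = N})))
        (H-mul (T^ N ⁻¹) (T^ N · g) (H-inv (T^ N) H-T)
          (H-Γ-p∤a (T^ N · g) (Γ-mul {N = N} (T^ N) g (Γ-T {N = N}) γ) (unit-after-T {N = N} p-prime g γ p∣a)))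

lemma3p1 : (p N : ℕ) → Prime p → NonZero N →
    IsClosedNormalSubgroup p (Γ p N) × Γ p N (T^ {p} N) ×
    ((H : M2 p → Set) → IsClosedNormalSubgroup p H → H (T^ {p} N) → (g : M2 p) → Γ p N g → H g)
lemma3p1 p N p-prime N≢0 =
  Γ-closed-normal {N = N} p-prime {{N≢0}} ,
  Γ-T {N = N} ,
  λ H H-cns H-T → Minimality.Γ⊆H p-prime H H-cns H-T
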